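{- Let $n,k$ be integers with $k\ge1$, $n>2k$. Then $\beta(P(n,k))=n$ if and only if $n$ is even and $k$ is odd.
   Context: $P(n,k)$ is the generalized Petersen graph with vertices $u_1,\dots,u_n,v_1,\dots,v_n$ and edges $u_iu_{i+1}$, $u_iv_i$, $v_iv_{i+k}$ (subscripts modulo $n$). $\beta(G)$ denotes the size of a minimum vertex cover of $G$. -}

module Defs where

open import Data.Nat using (ℕ; _+_; _%_; _≤_; NonZero)
open import Data.Nat.DivMod using (m%n<n)
open import Data.Fin using (Fin; toℕ; fromℕ<)
open import Data.Fin.Subset using (Subset; _∈_; ∣_∣)
open import Data.Product using (_×_; _,_; Σ)
open import Data.Sum using (_⊎_)

addMod : ∀ {n} .{{_ : NonZero n}} → Fin n → ℕ → Fin n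
addMod {n} i k = fromℕ< (m%n<n (toℕ i + k) n)

-- vertex set of P(n,k): u_i = outer i, v_i = inner i  (2n vertices)
data Vertex (n : ℕ) : Set where
  outer : Fin n → Vertex n
  inner : Fin n → Vertex n

data PEdge (n k : ℕ) .{{_ : NonZero n}} : Vertex n → Vertex n → Set where
  outerE : (i : Fin n) → PEdge n k (outer i) (outer (addMod i 1))
  spoke  : (i : Fin n) → PEdge n k (outer i) (inner i)
  innerE : (i : Fin n) → PEdge n k (inner i) (inner (addMod i k))

VSet : ℕ → Set
VSet n = Subset n × Subset n

_∈V_ : ∀ {n} → Vertex n → VSet n → Set
outer i ∈V (U , V) = i ∈ U
inner i ∈V (U , V) = i ∈ V

size : ∀ {n} → VSet n → ℕ
size (U , V) = ∣ U ∣ + ∣ V ∣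

IsVertexCover : (n k : ℕ) .{{_ : NonZero n}} → VSet n → Set
IsVertexCover n k C =
  ∀ {x y : Vertex n} → PEdge n k x y → x ∈V C ⊎ y ∈V C

CoverNumberIs : (n k : ℕ) .{{_ : NonZero n}} → ℕ → Set
CoverNumberIs n k m =
  Σ (VSet n) (λ C → IsVertexCover n k C × (size C ≡ m))
  × (∀ C → IsVertexCover n k C → m ≤ size C)
  where open import Relation.Binary.PropositionalEquality using (_≡_)

module Submission where

-- The n spokes u_i v_i form a perfect matching, so every vertex cover
-- has at least n vertices, and one of size exactly n contains exactly
-- one endpoint of every spoke: its inner part is the complement of its
-- outer part.  Record the outer part as a Boolean sequence X along the
-- outer cycle.  The outer edges say that X never has two consecutive
-- falses; the inner edges say that X m and X (m + k) are never both
-- true.  Together these force X to alternate, so X m = X 0 xor (m odd).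
-- Periodicity X n = X 0 then makes n even, and the inner edge v_0 v_k
-- makes k odd.  Conversely, when n is even and k is odd, the odd outer
-- vertices together with the even inner vertices form a cover of size n.

open import Defs
open import Data.Bool using (Bool; true; false; not; _xor_)
open import Data.Bool.Properties
  using (not-involutive; not-distribˡ-xor; not-distribʳ-xor; xor-identityʳ)
open import Data.Nat using (ℕ; zero; suc; _+_; _*_; _<_; _≤_; _%_; _/_; NonZero; z≤n; s≤s)
open import Data.Nat.Properties
  using (+-suc; +-comm; m≤m+n; m<m+n; m+[n∸m]≡n; <-irrefl; ≤-trans; ≤-<-trans; module ≤-Reasoning)
open import Data.Nat.DivMod using (m%n<n; m≡m%n+[m/n]*n; %-distribˡ-+; m%n%n≡m%n; [m+n]%n≡m%n)
open import Data.Nat.Divisibility using (_∣_; divides; ∣n⇒∣m*n)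
open import Data.Fin using (Fin; toℕ; fromℕ<; zero; suc)
open import Data.Fin.Properties using (toℕ-injective; toℕ-fromℕ<)
open import Data.Fin.Subset using (Subset; _∈_; _∉_; _∩_; ∁; ∣_∣; inside; outside)
open import Data.Fin.Subset.Properties
  using (drop-there; x∈p∩q⁺; x∈p⇒∣p-x∣<∣p∣; x∉p⇒x∈∁p; ∣∁p∣≡n∸∣p∣; ∣p∣≤n)
open import Data.Vec using (_∷_; []; lookup; tabulate)
open import Data.Vec.Properties using ([]=⇒lookup; lookup⇒[]=; lookup∘tabulate)
open import Data.Product using (_×_; _,_)
open import Data.Sum using (_⊎_; inj₁; inj₂)
open import Data.Empty using (⊥; ⊥-elim)
open import Function using (case_of_)
open import Function.Bundles using (_⇔_; mk⇔)
open import Relation.Nullary using (¬_)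
open import Relation.Binary.PropositionalEquality

odd : ℕ → Bool
odd zero    = false
odd (suc m) = not (odd m)

odd-+ : ∀ m n → odd (m + n) ≡ odd m xor odd n
odd-+ zero    n = refl
odd-+ (suc m) n = trans (cong not (odd-+ m n)) (not-distribˡ-xor (odd m) (odd n))

even⇒¬odd : ∀ {m} → 2 ∣ m → odd m ≡ false
even⇒¬odd (divides q refl) = odd-double q
  where
  odd-double : ∀ q → odd (q * 2) ≡ false
  odd-double zero    = refl
  odd-double (suc q) = trans (not-involutive (odd (q * 2))) (odd-double q)

¬odd⇒even : ∀ m → odd m ≡ false → 2 ∣ m
¬odd⇒even zero          _ = divides 0 refl
¬odd⇒even (suc zero)    ()
¬odd⇒even (suc (suc m)) p with ¬odd⇒even m (trans (sym (not-involutive (odd m))) p)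
... | divides q eq = divides (suc q) (cong (2 +_) eq)

¬even⇒odd : ∀ {m} → ¬ (2 ∣ m) → odd m ≡ true
¬even⇒odd {m} ¬2∣m with odd m in e
... | true  = refl
... | false = ⊥-elim (¬2∣m (¬odd⇒even m e))

odd-% : ∀ m n .{{_ : NonZero n}} → 2 ∣ n → odd (m % n) ≡ odd m
odd-% m n 2∣n = sym (begin
  odd m                                      ≡⟨ cong odd (m≡m%n+[m/n]*n m n) ⟩
  odd (m % n + m / n * n)                    ≡⟨ odd-+ (m % n) (m / n * n) ⟩
  odd (m % n) xor odd (m / n * n)            ≡⟨ cong (odd (m % n) xor_) (even⇒¬odd (∣n⇒∣m*n (m / n) 2∣n)) ⟩
  odd (m % n) xor false                      ≡⟨ xor-identityʳ (odd (m % n)) ⟩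
  odd (m % n)                                ∎)
  where open ≡-Reasoning

Alternating : (ℕ → Bool) → Set
Alternating X = ∀ m → X (suc m) ≡ not (X m)

alternating-odd : ∀ {X} → Alternating X → ∀ m → X m ≡ X 0 xor odd m
alternating-odd {X} alt zero    = sym (xor-identityʳ (X 0))
alternating-odd {X} alt (suc m) =
  trans (alt m) (trans (cong not (alternating-odd alt m)) (not-distribʳ-xor (X 0) (odd m)))

alternating-period-even : ∀ {X} → Alternating X → ∀ n → X n ≡ X 0 → 2 ∣ n
alternating-period-even {X} alt n period =
  ¬odd⇒even n (xor-fixed (X 0) (odd n) (trans (sym (alternating-odd alt n)) period))
  where
  xor-fixed : ∀ x y → x xor y ≡ x → y ≡ false
  xor-fixed false false _ = refl
  xor-fixed true  false _ = refl
  xor-fixed false true  ()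
  xor-fixed true  true  ()

-- The two local constraints a tight cover puts on its outer part X:
-- no two consecutive falses (outer edges), and never X m = X (m + k) = true
-- (inner edges: in a tight cover v_m is present exactly when X m is false).
NoTwoFalse : (ℕ → Bool) → Set
NoTwoFalse X = ∀ m → X m ≡ true ⊎ X (suc m) ≡ true

NoTrueAtDistance : ℕ → (ℕ → Bool) → Set
NoTrueAtDistance k X = ∀ m → X m ≡ false ⊎ X (m + k) ≡ false

-- These constraints force alternation: if X m = X (m+1) = true then
-- X (m+k) = X (m+k+1) = false, contradicting the first constraint.
constraints-alternate : ∀ {k X} → NoTwoFalse X → NoTrueAtDistance k X → Alternating X
constraints-alternate {k} twoFalse atDist m =
  local (twoFalse m) (atDist m) (atDist (suc m)) (twoFalse (m + k))
  where
  local : ∀ {a b c d} → a ≡ true ⊎ b ≡ true → a ≡ false ⊎ c ≡ false →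
          b ≡ false ⊎ d ≡ false → c ≡ true ⊎ d ≡ true → b ≡ not a
  local {false} (inj₂ refl) _ _ _ = refl
  local {true} {false} _ _ _ _ = refl
  local {true} {true} _ (inj₁ ()) _ _
  local {true} {true} _ (inj₂ refl) (inj₁ ()) _
  local {true} {true} _ (inj₂ refl) (inj₂ refl) (inj₁ ())
  local {true} {true} _ (inj₂ refl) (inj₂ refl) (inj₂ ())

-- In an alternating sequence X k = X 0 and X (k+1) = X 1 = not (X 0) for even k,
-- so the constraint at distance k fails at m = 0 or at m = 1.
alternating-distance-odd : ∀ {k X} → Alternating X → NoTrueAtDistance k X → ¬ (2 ∣ k)
alternating-distance-odd {k} {X} alt atDist 2∣k =
  both-false (Data.Sum.map₂ (trans (sym Xk≡X0)) (atDist 0))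
             (Data.Sum.map (trans (sym (alt 0))) (trans (sym Xk+1≡notX0)) (atDist 1))
  where
  Xk≡X0 : X k ≡ X 0
  Xk≡X0 = trans (alternating-odd alt k) (trans (cong (X 0 xor_) (even⇒¬odd 2∣k)) (xor-identityʳ (X 0)))

  Xk+1≡notX0 : X (suc k) ≡ not (X 0)
  Xk+1≡notX0 = trans (alt k) (cong not Xk≡X0)

  both-false : ∀ {a} → a ≡ false ⊎ a ≡ false → not a ≡ false ⊎ not a ≡ false → ⊥
  both-false {true}  (inj₁ ()) _
  both-false {true}  (inj₂ ()) _
  both-false {false} _ (inj₁ ())
  both-false {false} _ (inj₂ ())

covers-tail : ∀ {n a b} {U V : Subset n} →
              (∀ i → i ∈ a ∷ U ⊎ i ∈ b ∷ V) → ∀ i → i ∈ U ⊎ i ∈ V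
covers-tail cov i = Data.Sum.map drop-there drop-there (cov (suc i))

covering-bound : ∀ {n} (U V : Subset n) → (∀ i → i ∈ U ⊎ i ∈ V) →
                 n + ∣ U ∩ V ∣ ≤ ∣ U ∣ + ∣ V ∣
covering-bound []           []           _   = z≤n
covering-bound {suc n} (inside ∷ U) (inside ∷ V) cov =
  s≤s (subst₂ _≤_ (sym (+-suc n ∣ U ∩ V ∣)) (sym (+-suc ∣ U ∣ ∣ V ∣))
                  (s≤s (covering-bound U V (covers-tail cov))))
covering-bound (inside ∷ U) (outside ∷ V) cov = s≤s (covering-bound U V (covers-tail cov))
covering-bound {suc n} (outside ∷ U) (inside ∷ V) cov =
  subst (suc n + ∣ U ∩ V ∣ ≤_) (sym (+-suc ∣ U ∣ ∣ V ∣)) (s≤s (covering-bound U V (covers-tail cov)))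
covering-bound (outside ∷ U) (outside ∷ V) cov with cov zero
... | inj₁ ()
... | inj₂ ()

∉⇒lookup-false : ∀ {n} {i : Fin n} {U : Subset n} → i ∉ U → lookup U i ≡ false
∉⇒lookup-false {i = i} {U} i∉U with lookup U i in eq
... | false = refl
... | true  = ⊥-elim (i∉U (lookup⇒[]= i U eq))

complement-size : ∀ {n} (U : Subset n) → size (U , ∁ U) ≡ n
complement-size U = trans (cong (∣ U ∣ +_) (∣∁p∣≡n∸∣p∣ U)) (m+[n∸m]≡n (∣p∣≤n U))

module _ (n : ℕ) .{{_ : NonZero n}} where

  position : ℕ → Fin n
  position m = fromℕ< (m%n<n m n)

  position-+ : ∀ m j → addMod (position m) j ≡ position (m + j)
  position-+ m j = toℕ-injective (begin
    toℕ (addMod (position m) j)  ≡⟨ toℕ-fromℕ< _ ⟩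
    (toℕ (position m) + j) % n   ≡⟨ cong (λ t → (t + j) % n) (toℕ-fromℕ< _) ⟩
    (m % n + j) % n              ≡⟨ %-distribˡ-+ (m % n) j n ⟩
    (m % n % n + j % n) % n      ≡⟨ cong (λ t → (t + j % n) % n) (m%n%n≡m%n m n) ⟩
    (m % n + j % n) % n          ≡⟨ %-distribˡ-+ m j n ⟨
    (m + j) % n                  ≡⟨ toℕ-fromℕ< _ ⟨
    toℕ (position (m + j))       ∎)
    where open ≡-Reasoning

  position-period : position n ≡ position 0
  position-period = toℕ-injective (begin
    toℕ (position n)  ≡⟨ toℕ-fromℕ< _ ⟩
    (0 + n) % n       ≡⟨ [m+n]%n≡m%n 0 n ⟩
    0 % n             ≡⟨ toℕ-fromℕ< _ ⟨
    toℕ (position 0)  ∎)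
    where open ≡-Reasoning

  odd-addMod : 2 ∣ n → ∀ i j → odd (toℕ (addMod i j)) ≡ odd (toℕ i) xor odd j
  odd-addMod 2∣n i j = begin
    odd (toℕ (addMod i j))   ≡⟨ cong odd (toℕ-fromℕ< (m%n<n (toℕ i + j) n)) ⟩
    odd ((toℕ i + j) % n)    ≡⟨ odd-% (toℕ i + j) n 2∣n ⟩
    odd (toℕ i + j)          ≡⟨ odd-+ (toℕ i) j ⟩
    odd (toℕ i) xor odd j    ∎
    where open ≡-Reasoning

  oddPositions : Subset n
  oddPositions = tabulate (λ i → odd (toℕ i))

  odd⇒∈oddPositions : ∀ {i} → odd (toℕ i) ≡ true → i ∈ oddPositions
  odd⇒∈oddPositions {i} p = lookup⇒[]= i oddPositions (trans (lookup∘tabulate _ i) p)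

  even⇒∈∁oddPositions : ∀ {i} → odd (toℕ i) ≡ false → i ∈ ∁ oddPositions
  even⇒∈∁oddPositions {i} p = x∉p⇒x∈∁p λ i∈U →
    case trans (sym p) (trans (sym (lookup∘tabulate _ i)) ([]=⇒lookup i∈U)) of λ ()

module _ (n k : ℕ) .{{_ : NonZero n}} where

  -- The spokes: every cover contains u_i or v_i, so it has at least
  -- n + (number of spokes with both ends in the cover) vertices.
  cover-bound : ∀ {U V} → IsVertexCover n k (U , V) → n + ∣ U ∩ V ∣ ≤ size (U , V)
  cover-bound {U} {V} cov = covering-bound U V (λ i → cov (spoke i))

  cover-size-≥ : ∀ C → IsVertexCover n k C → n ≤ size C
  cover-size-≥ (U , V) cov = ≤-trans (m≤m+n n ∣ U ∩ V ∣) (cover-bound cov)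

  tight-cover-exclusive : ∀ {U V} → IsVertexCover n k (U , V) → size (U , V) ≡ n →
                          ∀ {i} → i ∈ V → i ∉ U
  tight-cover-exclusive {U} {V} cov tight i∈V i∈U = <-irrefl refl (begin-strict
    n                 <⟨ m<m+n n (≤-<-trans z≤n (x∈p⇒∣p-x∣<∣p∣ (x∈p∩q⁺ (i∈U , i∈V)))) ⟩
    n + ∣ U ∩ V ∣     ≤⟨ cover-bound cov ⟩
    size (U , V)      ≡⟨ tight ⟩
    n                 ∎)
    where open ≤-Reasoning

  tight-cover-parity : ∀ {U V} → IsVertexCover n k (U , V) → size (U , V) ≡ n →
                       (2 ∣ n) × ¬ (2 ∣ k)
  tight-cover-parity {U} {V} cov tight =
    alternating-period-even alternates n (cong (lookup U) (position-period n)) ,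
    alternating-distance-odd alternates noTrueAtDistance
    where
    X : ℕ → Bool
    X m = lookup U (position n m)

    noTwoFalse : NoTwoFalse X
    noTwoFalse m = Data.Sum.map []=⇒lookup
      (λ p → trans (cong (lookup U) (sym next)) ([]=⇒lookup p)) (cov (outerE (position n m)))
      where
      next : addMod (position n m) 1 ≡ position n (suc m)
      next = trans (position-+ n m 1) (cong (position n) (+-comm m 1))

    noTrueAtDistance : NoTrueAtDistance k X
    noTrueAtDistance m = Data.Sum.map outside-U
      (λ p → trans (cong (lookup U) (sym (position-+ n m k))) (outside-U p))
      (cov (innerE (position n m)))
      where
      outside-U : ∀ {i} → i ∈ V → lookup U i ≡ false
      outside-U i∈V = ∉⇒lookup-false (tight-cover-exclusive cov tight i∈V)

    alternates : Alternating X
    alternates = constraints-alternate noTwoFalse noTrueAtDistance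

  parity-cover : 2 ∣ n → ¬ (2 ∣ k) → IsVertexCover n k (oddPositions n , ∁ (oddPositions n))
  parity-cover 2∣n k-odd (outerE i) with odd (toℕ i) in e
  ... | true  = inj₁ (odd⇒∈oddPositions n e)
  ... | false = inj₂ (odd⇒∈oddPositions n (trans (odd-addMod n 2∣n i 1) (cong (_xor true) e)))
  parity-cover 2∣n k-odd (spoke i) with odd (toℕ i) in e
  ... | true  = inj₁ (odd⇒∈oddPositions n e)
  ... | false = inj₂ (even⇒∈∁oddPositions n e)
  parity-cover 2∣n k-odd (innerE i) with odd (toℕ i) in e
  ... | false = inj₁ (even⇒∈∁oddPositions n e)
  ... | true  = inj₂ (even⇒∈∁oddPositions n
        (trans (odd-addMod n 2∣n i k) (trans (cong (_xor odd k) e) (cong not (¬even⇒odd k-odd)))))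

proposition14 : (n k : ℕ) .{{_ : NonZero n}} → 1 ≤ k → 2 * k < n →
    CoverNumberIs n k n ⇔ ((2 ∣ n) × ¬ (2 ∣ k))
proposition14 n k _ _ = mk⇔ forward backward
  where
  forward : CoverNumberIs n k n → (2 ∣ n) × ¬ (2 ∣ k)
  forward (((U , V) , cov , tight) , _) = tight-cover-parity n k cov tight

  backward : (2 ∣ n) × ¬ (2 ∣ k) → CoverNumberIs n k n
  backward (2∣n , k-odd) =
    ((oddPositions n , ∁ (oddPositions n)) ,
     parity-cover n k 2∣n k-odd ,
     complement-size (oddPositions n)) ,
    cover-size-≥ n k
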